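{- Let $r\ge 2$ and $n\ge 0$. With $P_{n,\ell}^{(r)}$ the total number of points at level $\ell$ over all paths in $\mathcal{A}_{n,0}^{(r)}$, and $S_n^{(r)}=|\mathcal{A}_{n,0}^{(r)}|$, $$\sum_{\ell=1}^{n+1}(-1)^{\ell-1}\ell\, P_{n+1,\ell}^{(r)}=\sum_{\ell=0}^{n}S_{\ell+1}^{(r)}.$$
   Context: A Dyck path of length $2n$ is a lattice path from $(0,0)$ to $(2n,0)$ weakly above the $x$-axis with steps $\mathbf{u}=(1,1)$, $\mathbf{d}=(1,-1)$; an $r$-colored Dyck path has each $\mathbf{d}$-step colored with one of $r$ colors. $\mathcal{A}_{n,0}^{(r)}$ is the set of $r$-colored Dyck paths of length $2n$ with no two consecutive $\mathbf{d}$-steps of the same color. A point at level $\ell$ is a lattice point of the path with ordinate $\ell$. $S_n^{(r)}$ is the coefficient of $x^n$ in the power series $S_r(x)$ satisfying $S_r=1+xS_r+(r-1)xS_r^2$. -}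

module Defs where

open import Data.Nat using (ℕ; zero; suc; _+_; _*_; _∸_; _≡ᵇ_)
open import Data.Bool using (Bool; true; false; _∧_; not; if_then_else_)
open import Data.Fin using (Fin; _≟_)
open import Data.List using (List; []; _∷_; map; concatMap; filter; length; upTo; foldr; applyUpTo)
open import Data.List.Base using (allFin)
open import Data.Integer as ℤ using (ℤ; +_)
open import Relation.Nullary using (does)
open import Relation.Nullary.Decidable using (T?)

data Step (r : ℕ) : Set where
  up   : Step r
  down : Fin r → Step r

words : (r m : ℕ) → List (List (Step r))
words r zero    = [] ∷ []
words r (suc m) = concatMap (λ w → (up ∷ w) ∷ map (λ c → down c ∷ w) (allFin r)) (words r m)

dyckFrom : {r : ℕ} → ℕ → List (Step r) → Bool
dyckFrom h []                    = h ≡ᵇ 0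
dyckFrom h (up ∷ s)              = dyckFrom (suc h) s
dyckFrom zero (down _ ∷ s)       = false
dyckFrom (suc h) (down _ ∷ s)    = dyckFrom h s

noRepeatDown : {r : ℕ} → List (Step r) → Bool
noRepeatDown []                         = true
noRepeatDown (down c ∷ down c' ∷ s)     = not (does (c ≟ c')) ∧ noRepeatDown (down c' ∷ s)
noRepeatDown (_ ∷ s)                    = noRepeatDown s

valid : {r : ℕ} → List (Step r) → Bool
valid s = dyckFrom 0 s ∧ noRepeatDown s

open import Data.Bool using (T)

A : (r n : ℕ) → List (List (Step r))
A r n = filter (λ s → T? (valid s)) (words r (2 * n))

-- Number of lattice points at level ℓ of the path s started at height h
-- (all points, including the initial and final points).
pointsAt : {r : ℕ} → ℕ → ℕ → List (Step r) → ℕ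
pointsAt ℓ h s = (if h ≡ᵇ ℓ then 1 else 0) + rest h s
  where
  rest : ℕ → List (Step _) → ℕ
  rest h []             = 0
  rest h (up ∷ s)       = pointsAt ℓ (suc h) s
  rest h (down _ ∷ s)   = pointsAt ℓ (h ∸ 1) s

sumℕ : List ℕ → ℕ
sumℕ = foldr _+_ 0

sumℤ : List ℤ → ℤ
sumℤ = foldr ℤ._+_ (+ 0)

P : (r n ℓ : ℕ) → ℕ
P r n ℓ = sumℕ (map (pointsAt ℓ 0) (A r n))

-- S_n^{(r)} : coefficient of x^n in S_r(x), where S_r = 1 + x S_r + (r-1) x S_r².
-- Comparing coefficients: S_0 = 1, S_{m+1} = S_m + (r-1) Σ_{i+j=m} S_i S_j.
-- We compute the list [S_m, S_{m-1}, …, S_0].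
Slist : ℕ → ℕ → List ℕ
Slist r zero    = 1 ∷ []
Slist r (suc m) = (head′ prev + (r ∸ 1) * conv prev) ∷ prev
  where
  prev = Slist r m
  head′ : List ℕ → ℕ
  head′ []      = 0
  head′ (x ∷ _) = x
  -- Σ_{i+j=m} S_i S_j for prev = [S_m,…,S_0]: pair prev with its reverse.
  rev : List ℕ → List ℕ
  rev = foldr (λ x acc → acc Data.List.++ (x ∷ [])) []
  zipMul : List ℕ → List ℕ → ℕ
  zipMul (x ∷ xs) (y ∷ ys) = x * y + zipMul xs ys
  zipMul _ _ = 0
  conv : List ℕ → ℕ
  conv l = zipMul l (rev l)

S : (r n : ℕ) → ℕ
S r n with Slist r n
... | x ∷ _ = x
... | []    = 0

signedTerm : (r n ℓ : ℕ) → ℤ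
signedTerm r n ℓ = sign ℓ ℤ.* (+ (ℓ * P r (suc n) ℓ))
  where
  sign : ℕ → ℤ
  sign zero          = ℤ.- (+ 1)
  sign (suc zero)    = + 1
  sign (suc (suc k)) = sign k

module Submission where

-- Let w ℓ = (−1)^(ℓ−1) ℓ. Since w ℓ + w (ℓ + 1) = (−1)^ℓ, the sum of w over the points of a
-- Dyck path telescopes to the sum of (−1)^ℓ over its down steps, ℓ being the level a down step reaches;
-- so the left-hand side is D_{n+1}, the total signed number of down steps over 𝒜_{n+1,0}.
-- Path counts and signed counts both satisfy first-step recursions in the current height h and the
-- remaining length m, provided one records whether the previous step went down (then only r − 1 colours
-- are allowed). Splitting a walk at its first visit to height 0 gives
-- S_{k+1} = S_k + (r − 1) Σ_{i+j=k} S_i S_j for the path counts, so they are the S_k. For the signed counts,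
-- a two-step induction on m over all odd heights shows that right after a down step they equal the path
-- counts, and otherwise they grow by the number of walks of length m + 2; at height 1 this reads
-- D_{n+1} = D_n + S_{n+1}.

open import Level using (0ℓ)
open import Function using (_∘_)
open import Algebra.Bundles using (CommutativeSemiring)
open import Relation.Binary.Bundles using (Setoid)
open import Relation.Binary.PropositionalEquality as ≡
  using (_≡_; refl; sym; trans; cong; cong₂; module ≡-Reasoning)
open import Data.Bool using (Bool; true; false; if_then_else_)
open import Data.Nat using (ℕ; zero; suc; _≤_)
open import Data.Integer as ℤ using (ℤ; +_)
import Data.Integer.Properties
open import Data.List
  using (List; []; _∷_; _++_; map; foldr; concatMap; applyUpTo; applyDownFrom; zipWith; reverse)
open import Defs

module ListSum (R : CommutativeSemiring 0ℓ 0ℓ) where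

  open CommutativeSemiring R hiding (refl; sym; trans)
  open Setoid setoid using () renaming (refl to ≈-refl; sym to ≈-sym; trans to ≈-trans)
  open import Algebra.Properties.CommutativeSemigroup +-commutativeSemigroup using (interchange)
  open import Data.List.Properties using (map-++)
  open import Relation.Binary.Reasoning.Setoid setoid

  sum : List Carrier → Carrier
  sum = foldr _+_ 0#

  private variable X Y : Set

  sum-++ : ∀ (xs ys : List Carrier) → sum (xs ++ ys) ≈ sum xs + sum ys
  sum-++ []       ys = ≈-sym (+-identityˡ _)
  sum-++ (x ∷ xs) ys = ≈-trans (+-congˡ (sum-++ xs ys)) (≈-sym (+-assoc x _ _))

  sum-map-cong : ∀ {f g : X → Carrier} xs → (∀ x → f x ≈ g x) → sum (map f xs) ≈ sum (map g xs)
  sum-map-cong []       f≈g = ≈-refl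
  sum-map-cong (x ∷ xs) f≈g = +-cong (f≈g x) (sum-map-cong xs f≈g)

  sum-map-0 : ∀ (xs : List X) → sum (map (λ _ → 0#) xs) ≈ 0#
  sum-map-0 []       = ≈-refl
  sum-map-0 (x ∷ xs) = ≈-trans (+-identityˡ _) (sum-map-0 xs)

  sum-map-+ : ∀ (f g : X → Carrier) xs → sum (map (λ x → f x + g x) xs) ≈ sum (map f xs) + sum (map g xs)
  sum-map-+ f g []       = ≈-sym (+-identityˡ 0#)
  sum-map-+ f g (x ∷ xs) = ≈-trans (+-congˡ (sum-map-+ f g xs)) (interchange (f x) (g x) _ _)

  sum-map-*ˡ : ∀ c (f : X → Carrier) xs → sum (map (λ x → c * f x) xs) ≈ c * sum (map f xs)
  sum-map-*ˡ c f []       = ≈-sym (zeroʳ c)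
  sum-map-*ˡ c f (x ∷ xs) = ≈-trans (+-congˡ (sum-map-*ˡ c f xs)) (≈-sym (distribˡ c (f x) _))

  sum-map-swap : ∀ (G : X → Y → Carrier) xs ys →
    sum (map (λ x → sum (map (G x) ys)) xs) ≈ sum (map (λ y → sum (map (λ x → G x y) xs)) ys)
  sum-map-swap G []       ys = ≈-sym (sum-map-0 ys)
  sum-map-swap G (x ∷ xs) ys = ≈-trans (+-congˡ (sum-map-swap G xs ys)) (≈-sym (sum-map-+ (G x) _ ys))

  sum-concatMap : ∀ (g : X → List Y) (F : Y → Carrier) xs →
    sum (map F (concatMap g xs)) ≈ sum (map (λ x → sum (map F (g x))) xs)
  sum-concatMap g F []       = ≈-refl
  sum-concatMap g F (x ∷ xs) = begin
    sum (map F (g x ++ concatMap g xs))               ≡⟨ ≡.cong sum (map-++ F (g x) _) ⟩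
    sum (map F (g x) ++ map F (concatMap g xs))       ≈⟨ sum-++ (map F (g x)) _ ⟩
    sum (map F (g x)) + sum (map F (concatMap g xs))  ≈⟨ +-congˡ (sum-concatMap g F xs) ⟩
    sum (map F (g x)) + sum (map (λ x → sum (map F (g x))) xs) ∎

module ℤSum = ListSum Data.Integer.Properties.+-*-commutativeSemiring

two-step-induction : {M : ℕ → Set} → M 0 → M 1 → (∀ k → M k → M (suc (suc k))) → ∀ k → M k
two-step-induction m₀ m₁ step zero          = m₀
two-step-induction m₀ m₁ step (suc zero)    = m₁
two-step-induction m₀ m₁ step (suc (suc k)) = step k (two-step-induction m₀ m₁ step k)

double : ℕ → ℕ
double zero    = zero
double (suc k) = suc (suc (double k))

module LevelSums where

  open import Data.Nat using (_∸_; _≡ᵇ_; _≤_; _<_; z≤n; s≤s)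
  import Data.Nat as N
  import Data.Nat.Properties as N
  open import Data.Integer using (_+_; _-_; _*_; -_; 0ℤ; 1ℤ; -1ℤ)
  import Data.Integer.Properties as ℤ
  open import Data.Integer.Tactic.RingSolver using (solve-∀)
  open import Data.List using (length; upTo)
  open import Data.List.Properties using (map-upTo)
  open ℤSum using (sum-map-cong; sum-map-+)

  ⟦_⟧ : Bool → ℤ
  ⟦ true  ⟧ = 1ℤ
  ⟦ false ⟧ = 0ℤ

  indicator : ∀ b → + (if b then 1 else 0) ≡ ⟦ b ⟧
  indicator true  = refl
  indicator false = refl

  σ : ℕ → ℤ
  σ zero          = 1ℤ
  σ (suc zero)    = -1ℤ
  σ (suc (suc k)) = σ k

  σ-suc : ∀ k → σ (suc k) ≡ - σ k
  σ-suc zero          = refl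
  σ-suc (suc zero)    = refl
  σ-suc (suc (suc k)) = σ-suc k

  weight : ℕ → ℤ
  weight ℓ = - (σ ℓ * + ℓ)

  weight-step : ∀ ℓ → weight ℓ + weight (suc ℓ) ≡ σ ℓ
  weight-step ℓ rewrite σ-suc ℓ | ℤ.pos-+ 1 ℓ = telescope (σ ℓ) (+ ℓ)
    where
    telescope : ∀ s x → - (s * x) + - (- s * (1ℤ + x)) ≡ s
    telescope = solve-∀

  -- The sign in signedTerm is local to Defs. The induction is elaborated before ℓ is split, so its motive
  -- is solved by unification once the product and the hidden sign's parameter ℓ are abstracted.
  signedTerm≡ : ∀ r n ℓ → signedTerm r n ℓ ≡ weight ℓ * + P r (suc n) ℓ
  signedTerm≡ r n with (λ (a q : ℕ) → two-step-induction refl refl (λ _ eq → eq))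
  ... | hiddenSign≡-σ = λ ℓ → trans (signedTerm≡-σ ℓ) (sym (weight-cast ℓ (P r (suc n) ℓ)))
    where
    weight-cast : ∀ ℓ p → weight ℓ * + p ≡ - σ ℓ * + (ℓ N.* p)
    weight-cast ℓ p = trans (reassoc (σ ℓ) (+ ℓ) (+ p)) (cong (λ z → - σ ℓ * z) (sym (ℤ.pos-* ℓ p)))
      where
      reassoc : ∀ s x y → - (s * x) * y ≡ - s * (x * y)
      reassoc = solve-∀
    signedTerm≡-σ : ∀ ℓ → signedTerm r n ℓ ≡ - σ ℓ * + (ℓ N.* P r (suc n) ℓ)
    signedTerm≡-σ zero          = refl
    signedTerm≡-σ (suc zero)    = refl
    signedTerm≡-σ (suc (suc k)) with suc (suc k) N.* P r (suc n) (suc (suc k))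
    ... | q with suc (suc k)
    ...   | a = hiddenSign≡-σ a q k

  sum-none : ∀ (g : ℕ → ℤ) M → sumℤ (applyUpTo (λ i → g i * ⟦ 0 ≡ᵇ suc i ⟧) M) ≡ 0ℤ
  sum-none g zero    = refl
  sum-none g (suc M) = cong₂ _+_ (ℤ.*-zeroʳ (g 0)) (sum-none (g ∘ suc) M)

  sum-pick : ∀ (g : ℕ → ℤ) M x → x < M → sumℤ (applyUpTo (λ i → g i * ⟦ x ≡ᵇ i ⟧) M) ≡ g x
  sum-pick g (suc M) zero    _         =
    trans (cong₂ _+_ (ℤ.*-identityʳ (g 0)) (sum-none (g ∘ suc) M)) (ℤ.+-identityʳ (g 0))
  sum-pick g (suc M) (suc x) (s≤s x<M) =
    trans (cong₂ _+_ (ℤ.*-zeroʳ (g 0)) (sum-pick (g ∘ suc) M x x<M)) (ℤ.+-identityˡ (g (suc x)))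

  truncatedWeight : ∀ M x → x ≤ M →
    sumℤ (map (λ i → weight (suc i) * ⟦ x ≡ᵇ suc i ⟧) (upTo M)) ≡ weight x
  truncatedWeight M x x≤M = trans (cong sumℤ (map-upTo _ M)) (pick x x≤M)
    where
    pick : ∀ x → x ≤ M → sumℤ (applyUpTo (λ i → weight (suc i) * ⟦ x ≡ᵇ suc i ⟧) M) ≡ weight x
    pick zero    _   = sum-none (weight ∘ suc) M
    pick (suc x) x<M = sum-pick (weight ∘ suc) M x x<M

  double≡+ : ∀ k → double k ≡ k N.+ k
  double≡+ zero    = refl
  double≡+ (suc k) = cong suc (trans (cong suc (double≡+ k)) (sym (N.+-suc k k)))

  module _ {r : ℕ} where

    next : ℕ → Step r → ℕ
    next h up       = suc h
    next h (down _) = h ∸ 1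

    levelSum : (ℕ → ℤ) → ℕ → List (Step r) → ℤ
    levelSum u h []       = u h
    levelSum u h (st ∷ s) = u h + levelSum u (next h st) s

    downSum : (ℕ → ℤ) → ℕ → List (Step r) → ℤ
    downSum τ h []           = 0ℤ
    downSum τ h (up ∷ s)     = downSum τ (suc h) s
    downSum τ h (down _ ∷ s) = τ (h ∸ 1) + downSum τ (h ∸ 1) s

    potential : (ℕ → ℤ) → ℕ → ℤ
    potential u zero    = u 0
    potential u (suc h) = potential u h - u h

    pointsAt≡levelSum : ∀ ℓ h s → + pointsAt ℓ h s ≡ levelSum (λ x → ⟦ x ≡ᵇ ℓ ⟧) h s
    pointsAt≡levelSum ℓ h []       = trans (cong +_ (N.+-identityʳ _)) (indicator (h ≡ᵇ ℓ))
    pointsAt≡levelSum ℓ h (st ∷ s) = begin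
      + pointsAt ℓ h (st ∷ s)
        ≡⟨ cong +_ (pointsAt-∷ st) ⟩
      + (atℓ N.+ pointsAt ℓ (next h st) s)
        ≡⟨ ℤ.pos-+ atℓ (pointsAt ℓ (next h st) s) ⟩
      + atℓ + + pointsAt ℓ (next h st) s
        ≡⟨ cong₂ _+_ (indicator (h ≡ᵇ ℓ)) (pointsAt≡levelSum ℓ (next h st) s) ⟩
      ⟦ h ≡ᵇ ℓ ⟧ + levelSum (λ x → ⟦ x ≡ᵇ ℓ ⟧) (next h st) s ∎
      where
      open ≡-Reasoning
      atℓ : ℕ
      atℓ = if h ≡ᵇ ℓ then 1 else 0
      pointsAt-∷ : ∀ st → pointsAt ℓ h (st ∷ s) ≡ atℓ N.+ pointsAt ℓ (next h st) s
      pointsAt-∷ up       = refl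
      pointsAt-∷ (down _) = refl

    levelSum-*ˡ : ∀ c u h s → c * levelSum u h s ≡ levelSum (λ x → c * u x) h s
    levelSum-*ˡ c u h []       = refl
    levelSum-*ˡ c u h (st ∷ s) =
      trans (ℤ.*-distribˡ-+ c (u h) _) (cong (_+_ (c * u h)) (levelSum-*ˡ c u (next h st) s))

    levelSum-sum : ∀ {I : Set} (F : I → ℕ → ℤ) is h s →
      sumℤ (map (λ i → levelSum (F i) h s) is) ≡ levelSum (λ x → sumℤ (map (λ i → F i x) is)) h s
    levelSum-sum F is h []       = refl
    levelSum-sum F is h (st ∷ s) = trans (sum-map-+ (λ i → F i h) _ is)
      (cong (_+_ (sumℤ (map (λ i → F i h) is))) (levelSum-sum F is (next h st) s))

    height≤length : ∀ h (s : List (Step r)) → dyckFrom h s ≡ true → h ≤ length s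
    height≤length zero    []           _    = z≤n
    height≤length h       (up ∷ s)     dyck =
      N.m≤n⇒m≤1+n (N.≤-trans (N.n≤1+n h) (height≤length (suc h) s dyck))
    height≤length (suc h) (down _ ∷ s) dyck = s≤s (height≤length h s dyck)

    height-bounded : ∀ M h (s : List (Step r)) → dyckFrom h s ≡ true → h N.+ length s ≤ M N.+ M → h ≤ M
    height-bounded M h s dyck bound = N.≮⇒≥ λ M<h →
      N.<⇒≱ (N.+-mono-< M<h M<h) (N.≤-trans (N.+-monoʳ-≤ h (height≤length h s dyck)) bound)

    levelSum-cong : ∀ {u v : ℕ → ℤ} M h (s : List (Step r)) →
                    dyckFrom h s ≡ true → h N.+ length s ≤ M N.+ M →
                    (∀ ℓ → ℓ ≤ M → u ℓ ≡ v ℓ) → levelSum u h s ≡ levelSum v h s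
    levelSum-cong M h []           dyck bound u≗v = u≗v h (height-bounded M h [] dyck bound)
    levelSum-cong M h (up ∷ s)     dyck bound u≗v = cong₂ _+_
      (u≗v h (height-bounded M h (up ∷ s) dyck bound))
      (levelSum-cong M (suc h) s dyck (N.≤-trans (N.≤-reflexive (sym (N.+-suc h (length s)))) bound) u≗v)
    levelSum-cong M (suc h) (down c ∷ s) dyck bound u≗v = cong₂ _+_
      (u≗v (suc h) (height-bounded M (suc h) (down c ∷ s) dyck bound))
      (levelSum-cong M h s dyck (N.≤-trans (N.+-monoʳ-≤ h (N.n≤1+n (length s))) (N.≤-trans (N.n≤1+n _) bound)) u≗v)

    levelSum-telescope : ∀ {u τ : ℕ → ℤ} → (∀ ℓ → u ℓ + u (suc ℓ) ≡ τ ℓ) →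
                         ∀ h (s : List (Step r)) → dyckFrom h s ≡ true →
                         levelSum u h s ≡ potential u h + downSum τ h s
    levelSum-telescope {u} {τ} step zero    []           _    = sym (ℤ.+-identityʳ (u 0))
    levelSum-telescope {u} {τ} step h       (up ∷ s)     dyck = begin
      u h + levelSum u (suc h) s
        ≡⟨ cong (_+_ (u h)) (levelSum-telescope step (suc h) s dyck) ⟩
      u h + (potential u h - u h + downSum τ (suc h) s)
        ≡⟨ cancel (u h) (potential u h) (downSum τ (suc h) s) ⟩
      potential u h + downSum τ (suc h) s ∎
      where
      open ≡-Reasoning
      cancel : ∀ x p d → x + (p - x + d) ≡ p + d
      cancel = solve-∀
    levelSum-telescope {u} {τ} step (suc h) (down _ ∷ s) dyck = begin
      u (suc h) + levelSum u h s
        ≡⟨ cong (_+_ (u (suc h))) (levelSum-telescope step h s dyck) ⟩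
      u (suc h) + (potential u h + downSum τ h s)
        ≡⟨ shift (u h) (u (suc h)) (potential u h) (downSum τ h s) ⟩
      potential u h - u h + ((u h + u (suc h)) + downSum τ h s)
        ≡⟨ cong (λ t → potential u h - u h + (t + downSum τ h s)) (step h) ⟩
      potential u h - u h + (τ h + downSum τ h s) ∎
      where
      open ≡-Reasoning
      shift : ∀ x y p d → y + (p + d) ≡ p - x + ((x + y) + d)
      shift = solve-∀

    signedPoints≡signedDowns : ∀ M (s : List (Step r)) → dyckFrom 0 s ≡ true → length s ≡ double M →
      sumℤ (map (λ i → weight (suc i) * + pointsAt (suc i) 0 s) (upTo M)) ≡ downSum σ 0 s
    signedPoints≡signedDowns M s dyck length≡ = begin
      sumℤ (map (λ i → weight (suc i) * + pointsAt (suc i) 0 s) (upTo M))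
        ≡⟨ sum-map-cong (upTo M) (λ i → trans (cong (weight (suc i) *_) (pointsAt≡levelSum (suc i) 0 s))
                                             (levelSum-*ˡ (weight (suc i)) _ 0 s)) ⟩
      sumℤ (map (λ i → levelSum (λ x → weight (suc i) * ⟦ x ≡ᵇ suc i ⟧) 0 s) (upTo M))
        ≡⟨ levelSum-sum (λ i x → weight (suc i) * ⟦ x ≡ᵇ suc i ⟧) (upTo M) 0 s ⟩
      levelSum (λ x → sumℤ (map (λ i → weight (suc i) * ⟦ x ≡ᵇ suc i ⟧) (upTo M))) 0 s
        ≡⟨ levelSum-cong M 0 s dyck (N.≤-reflexive (trans length≡ (double≡+ M))) (truncatedWeight M) ⟩
      levelSum weight 0 s
        ≡⟨ levelSum-telescope weight-step 0 s dyck ⟩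
      0ℤ + downSum σ 0 s
        ≡⟨ ℤ.+-identityˡ _ ⟩
      downSum σ 0 s ∎
      where open ≡-Reasoning

module Convolution where

  open import Data.Nat using (_+_; _*_; _∸_)
  open import Data.Nat.Properties
  open import Data.Nat.Tactic.RingSolver using (solve-∀)
  open import Data.List.Properties using (reverse-applyUpTo; reverse-involutive)

  private
    distrib : ∀ x y z u v → (x + y) * z + (u + v) ≡ (x * z + u) + (y * z + v)
    distrib = solve-∀
    scale : ∀ c x y u → c * x * y + c * u ≡ c * (x * y + u)
    scale = solve-∀

  infixl 7 _⋆_

  _⋆_ : (ℕ → ℕ) → (ℕ → ℕ) → ℕ → ℕ
  (a ⋆ b) m = sumℕ (applyUpTo (λ i → a i * b (m ∸ i)) (suc m))

  ⋆-cong : ∀ {a a′ b b′} m → (∀ i → a i ≡ a′ i) → (∀ i → b i ≡ b′ i) → (a ⋆ b) m ≡ (a′ ⋆ b′) m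
  ⋆-cong zero    a≗a′ b≗b′ = cong₂ _+_ (cong₂ _*_ (a≗a′ 0) (b≗b′ 0)) refl
  ⋆-cong (suc m) a≗a′ b≗b′ =
    cong₂ _+_ (cong₂ _*_ (a≗a′ 0) (b≗b′ (suc m))) (⋆-cong m (a≗a′ ∘ suc) b≗b′)

  ⋆-distribʳ-+ : ∀ a a′ b m → ((λ i → a i + a′ i) ⋆ b) m ≡ (a ⋆ b) m + (a′ ⋆ b) m
  ⋆-distribʳ-+ a a′ b zero    = distrib (a 0) (a′ 0) (b 0) 0 0
  ⋆-distribʳ-+ a a′ b (suc m) =
    trans (cong (_+_ ((a 0 + a′ 0) * b (suc m))) (⋆-distribʳ-+ (a ∘ suc) (a′ ∘ suc) b m))
          (distrib (a 0) (a′ 0) (b (suc m)) _ _)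

  ⋆-*ˡ : ∀ c a b m → ((λ i → c * a i) ⋆ b) m ≡ c * (a ⋆ b) m
  ⋆-*ˡ c a b zero    = trans (cong (_+_ (c * a 0 * b 0)) (sym (*-zeroʳ c))) (scale c (a 0) (b 0) 0)
  ⋆-*ˡ c a b (suc m) =
    trans (cong (_+_ (c * a 0 * b (suc m))) (⋆-*ˡ c (a ∘ suc) b m)) (scale c (a 0) (b (suc m)) _)

  δ : ℕ → ℕ
  δ zero    = 1
  δ (suc _) = 0

  δ-⋆ : ∀ b m → (δ ⋆ b) m ≡ b m
  δ-⋆ b zero    = trans (+-identityʳ (b 0 + 0)) (+-identityʳ (b 0))
  δ-⋆ b (suc m) = trans (cong₂ _+_ (+-identityʳ (b (suc m))) (zero-⋆ m)) (+-identityʳ (b (suc m)))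
    where
    zero-⋆ : ∀ m → ((λ _ → 0) ⋆ b) m ≡ 0
    zero-⋆ zero    = refl
    zero-⋆ (suc m) = zero-⋆ m

  ⋆-double : ∀ a b k → (∀ i → a (suc (double i)) ≡ 0) →
             (a ⋆ b) (double k) ≡ ((a ∘ double) ⋆ (b ∘ double)) k
  ⋆-double a b zero    a-odd = refl
  ⋆-double a b (suc k) a-odd = cong (_+_ (a 0 * b (double (suc k)))) (begin
    a 1 * b (suc (double k)) + ((a ∘ suc ∘ suc) ⋆ b) (double k)
      ≡⟨ cong (λ x → x * b (suc (double k)) + ((a ∘ suc ∘ suc) ⋆ b) (double k)) (a-odd 0) ⟩
    ((a ∘ suc ∘ suc) ⋆ b) (double k)
      ≡⟨ ⋆-double (a ∘ suc ∘ suc) b k (a-odd ∘ suc) ⟩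
    ((a ∘ double ∘ suc) ⋆ (b ∘ double)) k ∎)
    where open ≡-Reasoning

  ⋆-as-dot : ∀ a m → let D = applyDownFrom a (suc m) in sumℕ (zipWith _*_ D (reverse D)) ≡ (a ⋆ a) m
  ⋆-as-dot a m = cong sumℕ (begin
    zipWith _*_ (applyDownFrom a (suc m)) (reverse (applyDownFrom a (suc m)))
      ≡⟨ cong₂ (zipWith _*_) (applyDownFrom-as-applyUpTo m) reverse-applyDownFrom ⟩
    zipWith _*_ (applyUpTo (λ i → a (m ∸ i)) (suc m)) (applyUpTo a (suc m))
      ≡⟨ zipWith-*-comm (λ i → a (m ∸ i)) a (suc m) ⟩
    applyUpTo (λ i → a i * a (m ∸ i)) (suc m) ∎)
    where
    open ≡-Reasoning
    applyDownFrom-as-applyUpTo : ∀ m → applyDownFrom a (suc m) ≡ applyUpTo (λ i → a (m ∸ i)) (suc m)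
    applyDownFrom-as-applyUpTo zero    = refl
    applyDownFrom-as-applyUpTo (suc m) = cong (a (suc m) ∷_) (applyDownFrom-as-applyUpTo m)
    reverse-applyDownFrom : reverse (applyDownFrom a (suc m)) ≡ applyUpTo a (suc m)
    reverse-applyDownFrom = trans (cong reverse (sym (reverse-applyUpTo a (suc m)))) (reverse-involutive _)
    zipWith-*-comm : ∀ f g n → zipWith _*_ (applyUpTo f n) (applyUpTo g n) ≡ applyUpTo (λ i → g i * f i) n
    zipWith-*-comm f g zero    = refl
    zipWith-*-comm f g (suc n) = cong₂ _∷_ (*-comm (f 0) (g 0)) (zipWith-*-comm (f ∘ suc) (g ∘ suc) n)

module SlistUnfolding where

  open import Data.Nat using (_+_; _*_; _∸_)
  open import Data.List.Properties using (unfold-reverse)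

  dot-unique : (z : List ℕ → List ℕ → ℕ) →
    (∀ x xs y ys → z (x ∷ xs) (y ∷ ys) ≡ x * y + z xs ys) →
    (∀ ys → z [] ys ≡ 0) → (∀ x xs → z (x ∷ xs) [] ≡ 0) →
    ∀ xs ys → z xs ys ≡ sumℕ (zipWith _*_ xs ys)
  dot-unique z z∷∷ z[] z∷[] []       ys       = z[] ys
  dot-unique z z∷∷ z[] z∷[] (x ∷ xs) []       = z∷[] x xs
  dot-unique z z∷∷ z[] z∷[] (x ∷ xs) (y ∷ ys) =
    trans (z∷∷ x xs y ys) (cong (_+_ (x * y)) (dot-unique z z∷∷ z[] z∷[] xs ys))

  snoc-reverse : ∀ (xs : List ℕ) → foldr (λ x acc → acc ++ x ∷ []) [] xs ≡ reverse xs
  snoc-reverse []       = refl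
  snoc-reverse (x ∷ xs) = trans (cong (_++ x ∷ []) (snoc-reverse xs)) (sym (unfold-reverse x xs))

  head-unique : (hd : List ℕ → ℕ) → (∀ x xs → hd (x ∷ xs) ≡ x) →
                ∀ {l x xs} → l ≡ x ∷ xs → hd l ≡ x
  head-unique hd hd∷ refl = hd∷ _ _

  -- Slist's helpers are local to Defs. Their metavariables are created before Slist r m (and its reversal,
  -- which unfolds to the foldr below) are abstracted, so unification can solve them.
  Slist-suc : ∀ r m {x xs} → Slist r m ≡ x ∷ xs →
    Slist r (suc m) ≡ (x + (r ∸ 1) * sumℕ (zipWith _*_ (x ∷ xs) (reverse (x ∷ xs)))) ∷ x ∷ xs
  Slist-suc r m {x} {xs}
    with head-unique _ (λ _ _ → refl) | dot-unique _ (λ _ _ _ _ → refl) (λ _ → refl) (λ _ _ → refl)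
  ... | hiddenHead≡ | hiddenDot≡ with Slist r m
  ... | L with foldr (λ y acc → acc ++ y ∷ []) [] L | snoc-reverse L
  ... | reversedL | reversedL≡ = λ eq →
    cong₂ _∷_ (cong₂ _+_ (hiddenHead≡ eq) (cong ((r ∸ 1) *_) (begin
      _                                     ≡⟨ hiddenDot≡ L reversedL ⟩
      sumℕ (zipWith _*_ L reversedL)        ≡⟨ cong (sumℕ ∘ zipWith _*_ L) reversedL≡ ⟩
      sumℕ (zipWith _*_ L (reverse L))      ≡⟨ cong (λ l → sumℕ (zipWith _*_ l (reverse l))) eq ⟩
      sumℕ (zipWith _*_ (x ∷ xs) (reverse (x ∷ xs))) ∎))) eq
    where open ≡-Reasoning

data Prev : Set where
  free afterDown : Prev

module Walks (r₁ : ℕ) where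

  open import Data.Nat using (_+_; _*_; parity)
  open import Data.Nat.Properties
  open import Data.Nat.Tactic.RingSolver using (solve-∀)
  open import Data.Parity.Base using (1ℙ)
  open Convolution
  open SlistUnfolding using (Slist-suc)

  r : ℕ
  r = suc r₁

  choices : Prev → ℕ
  choices free      = r
  choices afterDown = r₁

  -- Admissible coloured step sequences of length m from height h that stay weakly above 0 and end at 0;
  -- afterDown means the previous step went down, so its colour is not available to a next down step.
  walks : Prev → ℕ → ℕ → ℕ
  walks p zero    zero    = 1
  walks p (suc h) zero    = 0
  walks p zero    (suc m) = walks free 1 m
  walks p (suc h) (suc m) = walks free (suc (suc h)) m + choices p * walks afterDown h m

  -- The walks that reach height 0 only at their end.
  firstPassages : Prev → ℕ → ℕ → ℕ
  firstPassages p zero    zero    = 1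
  firstPassages p (suc h) zero    = 0
  firstPassages p zero    (suc m) = 0
  firstPassages p (suc h) (suc m) = firstPassages free (suc (suc h)) m + choices p * firstPassages afterDown h m

  walks-split : ∀ p d h m → walks p (suc d + h) m ≡ (firstPassages p (suc d) ⋆ walks afterDown h) m
  walks-split p d h zero    = refl
  walks-split p d h (suc m) = begin
    walks free (suc (suc d) + h) m + choices p * walks afterDown (d + h) m
      ≡⟨ cong₂ _+_ (walks-split free (suc d) h m) (cong (choices p *_) (split-afterDown d)) ⟩
    (F₂ ⋆ W) m + choices p * (F₀ ⋆ W) m
      ≡⟨ cong (_+_ ((F₂ ⋆ W) m)) (⋆-*ˡ (choices p) F₀ W m) ⟨
    (F₂ ⋆ W) m + ((λ j → choices p * F₀ j) ⋆ W) m
      ≡⟨ ⋆-distribʳ-+ F₂ (λ j → choices p * F₀ j) W m ⟨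
    (firstPassages p (suc d) ⋆ W) (suc m) ∎
    where
    open ≡-Reasoning
    F₂ F₀ W : ℕ → ℕ
    F₂ = firstPassages free (suc (suc d))
    F₀ = firstPassages afterDown d
    W  = walks afterDown h
    split-afterDown : ∀ d → walks afterDown (d + h) m ≡ (firstPassages afterDown d ⋆ W) m
    split-afterDown zero    = sym (trans (⋆-cong {b = W} m firstPassages-δ (λ _ → refl)) (δ-⋆ W m))
      where
      firstPassages-δ : ∀ j → firstPassages afterDown 0 j ≡ δ j
      firstPassages-δ zero    = refl
      firstPassages-δ (suc _) = refl
    split-afterDown (suc d) = walks-split afterDown d h m

  -- A first passage from h + 1 is a walk from h, lifted by one, followed by a down step. Unless the walk
  -- is empty and p = free, that step follows a down step, so r₁ colours are left for it.
  firstPassages-afterDown : ∀ h m → firstPassages afterDown (suc h) (suc m) ≡ r₁ * walks afterDown h m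
  firstPassages-free : ∀ h m → firstPassages free (suc (suc h)) (suc m) ≡ r₁ * walks free (suc h) m

  firstPassages-afterDown zero    zero    = refl
  firstPassages-afterDown (suc h) zero    = refl
  firstPassages-afterDown zero    (suc m) = begin
    firstPassages free 2 (suc m) + r₁ * 0 ≡⟨ cong₂ _+_ (firstPassages-free 0 m) (*-zeroʳ r₁) ⟩
    r₁ * walks free 1 m + 0              ≡⟨ +-identityʳ _ ⟩
    r₁ * walks free 1 m                  ∎
    where open ≡-Reasoning
  firstPassages-afterDown (suc h) (suc m) = begin
    firstPassages free (suc (suc (suc h))) (suc m) + r₁ * firstPassages afterDown (suc h) (suc m)
      ≡⟨ cong₂ _+_ (firstPassages-free (suc h) m) (cong (r₁ *_) (firstPassages-afterDown h m)) ⟩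
    r₁ * walks free (suc (suc h)) m + r₁ * (r₁ * walks afterDown h m)
      ≡⟨ *-distribˡ-+ r₁ _ _ ⟨
    r₁ * walks afterDown (suc h) (suc m) ∎
    where open ≡-Reasoning

  firstPassages-free h zero    = refl
  firstPassages-free h (suc m) = begin
    firstPassages free (suc (suc (suc h))) (suc m) + r * firstPassages afterDown (suc h) (suc m)
      ≡⟨ cong₂ _+_ (firstPassages-free (suc h) m) (cong (r *_) (firstPassages-afterDown h m)) ⟩
    r₁ * walks free (suc (suc h)) m + r * (r₁ * walks afterDown h m)
      ≡⟨ swap r₁ r _ _ ⟩
    r₁ * (walks free (suc (suc h)) m + r * walks afterDown h m) ∎
    where
    open ≡-Reasoning
    swap : ∀ a b x y → a * x + b * (a * y) ≡ a * (x + b * y)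
    swap = solve-∀

  dyckCount : ℕ → ℕ
  dyckCount = walks free 0

  walks-afterDown-0 : ∀ m → walks afterDown 0 m ≡ dyckCount m
  walks-afterDown-0 zero    = refl
  walks-afterDown-0 (suc m) = refl

  firstPassages-1 : ∀ j → firstPassages free 1 (suc j) ≡ r₁ * dyckCount j + δ j
  firstPassages-1 zero    = one-more r₁
    where
    one-more : ∀ a → suc a * 1 ≡ a * 1 + 1
    one-more = solve-∀
  firstPassages-1 (suc j) = cong₂ _+_ (firstPassages-free 0 j) (*-zeroʳ r)

  dyckCount-rec : ∀ m → dyckCount (suc (suc m)) ≡ dyckCount m + r₁ * (dyckCount ⋆ dyckCount) m
  dyckCount-rec m = begin
    walks free (suc 0 + 0) (suc m)
      ≡⟨ walks-split free 0 0 (suc m) ⟩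
    ((firstPassages free 1 ∘ suc) ⋆ walks afterDown 0) m
      ≡⟨ ⋆-cong m firstPassages-1 walks-afterDown-0 ⟩
    ((λ j → r₁ * dyckCount j + δ j) ⋆ dyckCount) m
      ≡⟨ ⋆-distribʳ-+ (λ j → r₁ * dyckCount j) δ dyckCount m ⟩
    ((λ j → r₁ * dyckCount j) ⋆ dyckCount) m + (δ ⋆ dyckCount) m
      ≡⟨ cong₂ _+_ (⋆-*ˡ r₁ dyckCount dyckCount m) (δ-⋆ dyckCount m) ⟩
    r₁ * (dyckCount ⋆ dyckCount) m + dyckCount m
      ≡⟨ +-comm _ (dyckCount m) ⟩
    dyckCount m + r₁ * (dyckCount ⋆ dyckCount) m ∎
    where open ≡-Reasoning

  walks-odd : ∀ p h m → parity (h + m) ≡ 1ℙ → walks p h m ≡ 0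
  walks-odd p zero    zero    ()
  walks-odd p (suc h) zero    odd = refl
  walks-odd p zero    (suc m) odd = walks-odd free 1 m odd
  walks-odd p (suc h) (suc m) odd = begin
    walks free (suc (suc h)) m + choices p * walks afterDown h m
      ≡⟨ cong₂ _+_ (walks-odd free (suc (suc h)) m odd′)
                   (cong (choices p *_) (walks-odd afterDown h m odd′)) ⟩
    0 + choices p * 0
      ≡⟨ *-zeroʳ (choices p) ⟩
    0 ∎
    where
    open ≡-Reasoning
    odd′ : parity (h + m) ≡ 1ℙ
    odd′ = trans (sym (cong (parity ∘ suc) (+-suc h m))) odd

  evenCount : ℕ → ℕ
  evenCount k = dyckCount (double k)

  evenCount-rec : ∀ k → evenCount (suc k) ≡ evenCount k + r₁ * (evenCount ⋆ evenCount) k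
  evenCount-rec k = trans (dyckCount-rec (double k))
                          (cong (λ c → evenCount k + r₁ * c) (⋆-double dyckCount dyckCount k dyckCount-odd))
    where
    parity-odd : ∀ i → parity (suc (double i)) ≡ 1ℙ
    parity-odd zero    = refl
    parity-odd (suc i) = parity-odd i
    dyckCount-odd : ∀ i → dyckCount (suc (double i)) ≡ 0
    dyckCount-odd i = walks-odd free 0 (suc (double i)) (parity-odd i)

  Slist≡ : ∀ m → Slist r m ≡ applyDownFrom evenCount (suc m)
  Slist≡ zero    = refl
  Slist≡ (suc m) = trans (Slist-suc r m (Slist≡ m)) (cong (_∷ E) (begin
    evenCount m + r₁ * sumℕ (zipWith _*_ E (reverse E))
      ≡⟨ cong (λ c → evenCount m + r₁ * c) (⋆-as-dot evenCount m) ⟩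
    evenCount m + r₁ * (evenCount ⋆ evenCount) m
      ≡⟨ evenCount-rec m ⟨
    evenCount (suc m) ∎))
    where
    open ≡-Reasoning
    E : List ℕ
    E = applyDownFrom evenCount (suc m)

  S≡evenCount : ∀ k → S r k ≡ evenCount k
  S≡evenCount k rewrite Slist≡ k = refl

module SignedWalks (r₁ : ℕ) where

  open import Data.Integer using (_+_; _*_; -_; 0ℤ; 1ℤ; -1ℤ)
  import Data.Integer.Properties as ℤ
  open import Data.Integer.Tactic.RingSolver using (solve-∀)
  open import Data.Product using (_×_; _,_; proj₁; proj₂)
  import Data.Nat as N
  import Data.Nat.Properties as N
  open import Data.Nat.ListAction.Properties using (sum-++)
  open import Data.List using (_∷ʳ_)
  open import Data.List.Properties using (applyUpTo-∷ʳ)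
  open Walks r₁
  open LevelSums using (σ)

  walksℤ : Prev → ℕ → ℕ → ℤ
  walksℤ p h m = + walks p h m

  -- The sum, over the walks counted by walks p h m, of (−1)^ℓ over their down steps, ℓ the level reached.
  signedDowns : Prev → ℕ → ℕ → ℤ
  signedDowns p h       zero    = 0ℤ
  signedDowns p zero    (suc m) = signedDowns free 1 m
  signedDowns p (suc h) (suc m) =
    signedDowns free (suc (suc h)) m + + choices p * (signedDowns afterDown h m + σ h * walksℤ afterDown h m)

  walksℤ-suc : ∀ p h m →
    walksℤ p (suc h) (suc m) ≡ walksℤ free (suc (suc h)) m + + choices p * walksℤ afterDown h m
  walksℤ-suc p h m = trans (ℤ.pos-+ (walks free (suc (suc h)) m) _)
                           (cong (_+_ (walksℤ free (suc (suc h)) m)) (ℤ.pos-* (choices p) _))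

  odd : ℕ → ℕ
  odd i = suc (double i)

  σ-double : ∀ i → σ (double i) ≡ 1ℤ
  σ-double zero    = refl
  σ-double (suc i) = σ-double i

  σ-odd : ∀ i → σ (odd i) ≡ -1ℤ
  σ-odd zero    = refl
  σ-odd (suc i) = σ-odd i

  Balanced : ℕ → Set
  Balanced m = ∀ i → signedDowns afterDown (odd i) m ≡ walksℤ afterDown (odd i) m

  Paired : ℕ → Set
  Paired m = ∀ i → signedDowns free (odd (suc i)) m + + r₁ * signedDowns free (odd i) m
                 ≡ walksℤ free (double (suc i)) (suc m)

  even-unfold : ∀ m → Balanced m → ∀ p i → signedDowns p (double i) (suc m) ≡ signedDowns free (odd i) m
  even-unfold m bal p zero    = refl
  even-unfold m bal p (suc i) rewrite bal i | σ-odd i =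
    vanish (signedDowns free (odd (suc i)) m) (+ choices p) (walksℤ afterDown (odd i) m)
    where
    vanish : ∀ x k w → x + k * (w + -1ℤ * w) ≡ x
    vanish = solve-∀

  odd-unfold : ∀ m → Balanced m → ∀ p i →
    signedDowns p (odd i) (suc (suc m)) ≡
    signedDowns free (odd (suc i)) m + + choices p * (signedDowns free (odd i) m + walksℤ afterDown (double i) (suc m))
  odd-unfold m bal p i rewrite σ-double i = begin
    E₂ + k * (E₀ + 1ℤ * w)
      ≡⟨ cong (λ t → E₂ + k * (E₀ + t)) (ℤ.*-identityˡ w) ⟩
    E₂ + k * (E₀ + w)
      ≡⟨ cong₂ (λ a b → a + k * (b + w)) (even-unfold m bal free (suc i)) (even-unfold m bal afterDown i) ⟩
    signedDowns free (odd (suc i)) m + k * (signedDowns free (odd i) m + w) ∎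
    where
    open ≡-Reasoning
    E₂ E₀ k w : ℤ
    E₂ = signedDowns free (double (suc i)) (suc m)
    E₀ = signedDowns afterDown (double i) (suc m)
    k  = + choices p
    w  = walksℤ afterDown (double i) (suc m)

  module _ {m} (bal : Balanced m) (pair : Paired m) where

    private
      D : ℕ → ℕ → ℤ
      D = signedDowns free
      W : Prev → ℕ → ℕ → ℤ
      W = walksℤ

    balanced-step : Balanced (suc (suc m))
    balanced-step i = begin
      signedDowns afterDown (odd i) (suc (suc m))
        ≡⟨ odd-unfold m bal afterDown i ⟩
      D (odd (suc i)) m + + r₁ * (D (odd i) m + W afterDown (double i) (suc m))
        ≡⟨ regroup (D (odd (suc i)) m) (+ r₁) (D (odd i) m) _ ⟩
      (D (odd (suc i)) m + + r₁ * D (odd i) m) + + r₁ * W afterDown (double i) (suc m)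
        ≡⟨ cong (λ t → t + + r₁ * W afterDown (double i) (suc m)) (pair i) ⟩
      W free (double (suc i)) (suc m) + + r₁ * W afterDown (double i) (suc m)
        ≡⟨ walksℤ-suc afterDown (double i) (suc m) ⟨
      W afterDown (odd i) (suc (suc m)) ∎
      where
      open ≡-Reasoning
      regroup : ∀ x k d w → x + k * (d + w) ≡ (x + k * d) + k * w
      regroup = solve-∀

    signedDowns-increment : ∀ i → D (odd i) (suc (suc m)) ≡ W free (odd i) (suc (suc m)) + D (odd i) m
    signedDowns-increment i = begin
      D (odd i) (suc (suc m))
        ≡⟨ odd-unfold m bal free i ⟩
      D (odd (suc i)) m + + r * (D (odd i) m + Y)
        ≡⟨ cong (λ k → D (odd (suc i)) m + k * (D (odd i) m + Y)) (ℤ.pos-+ 1 r₁) ⟩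
      D (odd (suc i)) m + (1ℤ + + r₁) * (D (odd i) m + Y)
        ≡⟨ regroup (D (odd (suc i)) m) (+ r₁) (D (odd i) m) Y ⟩
      (D (odd (suc i)) m + + r₁ * D (odd i) m) + (1ℤ + + r₁) * Y + D (odd i) m
        ≡⟨ cong (λ t → t + (1ℤ + + r₁) * Y + D (odd i) m) (pair i) ⟩
      W free (double (suc i)) (suc m) + (1ℤ + + r₁) * Y + D (odd i) m
        ≡⟨ cong (λ k → W free (double (suc i)) (suc m) + k * Y + D (odd i) m) (ℤ.pos-+ 1 r₁) ⟨
      W free (double (suc i)) (suc m) + + r * Y + D (odd i) m
        ≡⟨ cong (λ t → t + D (odd i) m) (walksℤ-suc free (double i) (suc m)) ⟨
      W free (odd i) (suc (suc m)) + D (odd i) m ∎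
      where
      open ≡-Reasoning
      Y : ℤ
      Y = W afterDown (double i) (suc m)
      regroup : ∀ x k d w → x + (1ℤ + k) * (d + w) ≡ (x + k * d) + (1ℤ + k) * w + d
      regroup = solve-∀

    paired-step : Paired (suc (suc m))
    paired-step i = begin
      D (odd (suc i)) (suc (suc m)) + + r₁ * D (odd i) (suc (suc m))
        ≡⟨ cong₂ (λ a b → a + + r₁ * b) (signedDowns-increment (suc i)) (signedDowns-increment i) ⟩
      (V + D (odd (suc i)) m) + + r₁ * (W free (odd i) (suc (suc m)) + D (odd i) m)
        ≡⟨ regroup V (D (odd (suc i)) m) (+ r₁) (W free (odd i) (suc (suc m))) (D (odd i) m) ⟩
      V + + r₁ * W free (odd i) (suc (suc m)) + (D (odd (suc i)) m + + r₁ * D (odd i) m)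
        ≡⟨ cong₂ (λ a b → V + + r₁ * a + b) (walksℤ-suc free (double i) (suc m)) (pair i) ⟩
      V + + r₁ * (X + + r * Y) + X
        ≡⟨ cong (λ k → V + + r₁ * (X + k * Y) + X) (ℤ.pos-+ 1 r₁) ⟩
      V + + r₁ * (X + (1ℤ + + r₁) * Y) + X
        ≡⟨ absorb V (+ r₁) X Y ⟩
      V + (1ℤ + + r₁) * (X + + r₁ * Y)
        ≡⟨ cong₂ (λ k t → V + k * t) (ℤ.pos-+ 1 r₁) (walksℤ-suc afterDown (double i) (suc m)) ⟨
      V + + r * W afterDown (odd i) (suc (suc m))
        ≡⟨ walksℤ-suc free (odd i) (suc (suc m)) ⟨
      W free (double (suc i)) (suc (suc (suc m))) ∎
      where
      open ≡-Reasoning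
      V X Y : ℤ
      V = W free (odd (suc i)) (suc (suc m))
      X = W free (double (suc i)) (suc m)
      Y = W afterDown (double i) (suc m)
      regroup : ∀ a b k c d → (a + b) + k * (c + d) ≡ a + k * c + (b + k * d)
      regroup = solve-∀
      absorb : ∀ a k x y → a + k * (x + (1ℤ + k) * y) + x ≡ a + (1ℤ + k) * (x + k * y)
      absorb = solve-∀

  invariants : ∀ m → Balanced m × Paired m
  invariants = two-step-induction (balanced-0 , paired-0) (balanced-1 , paired-1)
                                  (λ m (bal , pair) → balanced-step {m} bal pair , paired-step {m} bal pair)
    where
    balanced-0 : Balanced 0
    balanced-0 i = refl
    paired-0 : Paired 0
    paired-0 i = trans (vanish (+ r₁)) (sym (trans (walksℤ-suc free (odd i) 0) (vanish (+ r))))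
      where
      vanish : ∀ k → 0ℤ + k * 0ℤ ≡ 0ℤ
      vanish = solve-∀
    balanced-1 : Balanced 1
    balanced-1 i rewrite σ-double i =
      trans (unit (+ r₁) (walksℤ afterDown (double i) 0)) (sym (walksℤ-suc afterDown (double i) 0))
      where
      unit : ∀ k w → 0ℤ + k * (0ℤ + 1ℤ * w) ≡ 0ℤ + k * w
      unit = solve-∀
    paired-1 : Paired 1
    paired-1 i rewrite σ-double i = begin
      (0ℤ + + r * (0ℤ + 1ℤ * 0ℤ)) + + r₁ * (0ℤ + + r * (0ℤ + 1ℤ * w))
        ≡⟨ regroup (+ r) (+ r₁) w ⟩
      (0ℤ + + r * 0ℤ) + + r * (0ℤ + + r₁ * w)
        ≡⟨ cong₂ (λ a b → a + + r * b) (walksℤ-suc free (suc (suc (double i))) 0)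
                                        (walksℤ-suc afterDown (double i) 0) ⟨
      walksℤ free (odd (suc i)) 1 + + r * walksℤ afterDown (odd i) 1
        ≡⟨ walksℤ-suc free (odd i) 1 ⟨
      walksℤ free (double (suc i)) 2 ∎
      where
      open ≡-Reasoning
      w : ℤ
      w = walksℤ afterDown (double i) 0
      regroup : ∀ R k w → (0ℤ + R * (0ℤ + 1ℤ * 0ℤ)) + k * (0ℤ + R * (0ℤ + 1ℤ * w))
                        ≡ (0ℤ + R * 0ℤ) + R * (0ℤ + k * w)
      regroup = solve-∀

  signedDowns-closed : ∀ n → signedDowns free 0 (double (suc n)) ≡ + sumℕ (applyUpTo (λ k → S r (suc k)) (suc n))
  signedDowns-closed zero = begin
    0ℤ + + r * (0ℤ + 1ℤ * 1ℤ)  ≡⟨ unit (+ r) ⟩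
    0ℤ + + r * 1ℤ              ≡⟨ walksℤ-suc free 0 0 ⟨
    + evenCount 1              ≡⟨ cong +_ (trans (sym (S≡evenCount 1)) (sym (N.+-identityʳ (S r 1)))) ⟩
    + (S r 1 N.+ 0)            ∎
    where
    open ≡-Reasoning
    unit : ∀ k → 0ℤ + k * (0ℤ + 1ℤ * 1ℤ) ≡ 0ℤ + k * 1ℤ
    unit = solve-∀
  signedDowns-closed (suc n) = begin
    signedDowns free (odd 0) (suc (suc m))
      ≡⟨ signedDowns-increment {m} (proj₁ (invariants m)) (proj₂ (invariants m)) 0 ⟩
    + evenCount (suc (suc n)) + signedDowns free 0 (double (suc n))
      ≡⟨ cong₂ _+_ (cong +_ (sym (S≡evenCount (suc (suc n))))) (signedDowns-closed n) ⟩
    + S r (suc (suc n)) + + sumℕ (applyUpTo f (suc n))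
      ≡⟨ cong +_ (N.+-comm (S r (suc (suc n))) _) ⟩
    + (sumℕ (applyUpTo f (suc n)) N.+ f (suc n))
      ≡⟨ cong +_ (sum-snoc (applyUpTo f (suc n)) (f (suc n))) ⟨
    + sumℕ (applyUpTo f (suc n) ∷ʳ f (suc n))
      ≡⟨ cong (+_ ∘ sumℕ) (applyUpTo-∷ʳ f (suc n)) ⟩
    + sumℕ (applyUpTo f (suc (suc n))) ∎
    where
    open ≡-Reasoning
    m : ℕ
    m = suc (double n)
    f : ℕ → ℕ
    f k = S r (suc k)
    sum-snoc : ∀ xs x → sumℕ (xs ∷ʳ x) ≡ sumℕ xs N.+ x
    sum-snoc xs x = trans (sum-++ xs (x ∷ [])) (cong (N._+_ (sumℕ xs)) (N.+-identityʳ x))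

module PathSums (r₁ : ℕ) where

  open import Data.Nat using (_≡ᵇ_)
  import Data.Nat as N
  import Data.Nat.Properties as N
  open import Data.Integer using (_+_; _*_; 0ℤ; 1ℤ)
  import Data.Integer.Properties as ℤ
  open import Data.Integer.Tactic.RingSolver using (solve-∀)
  open import Data.Bool using (_∧_; not)
  open import Data.Bool.Properties using (∧-identityʳ; ∧-zeroʳ)
  open import Data.Fin using (Fin) renaming (zero to fzero; suc to fsuc)
  open import Data.Fin.Properties using (_≟_)
  open import Data.Maybe using (Maybe; just; nothing)
  open import Function using (id)
  open import Data.List using (length; allFin; tabulate; filter; upTo)
  open import Data.List.Properties using (map-tabulate; map-∘; map-upTo)
  open import Relation.Nullary using (does)
  open import Relation.Nullary.Decidable using (T?)
  open ℤSum
  open Walks r₁ using (r; choices)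
  open SignedWalks r₁ using (walksℤ; walksℤ-suc; signedDowns)
  open LevelSums using (⟦_⟧; σ; downSum; weight; signedTerm≡; double≡+)

  prev : Maybe (Fin r) → Prev
  prev nothing  = free
  prev (just _) = afterDown

  allowed : Maybe (Fin r) → Fin r → Bool
  allowed nothing   c = true
  allowed (just c₀) c = not (does (c₀ ≟ c))

  -- An automaton for valid: last is the colour of the previous step if that step went down.
  accepts : ℕ → Maybe (Fin r) → List (Step r) → Bool
  accepts h       last []           = h ≡ᵇ 0
  accepts h       last (up ∷ s)     = accepts (suc h) nothing s
  accepts zero    last (down c ∷ s) = false
  accepts (suc h) last (down c ∷ s) = allowed last c ∧ accepts h (just c) s

  accepts-fresh : ∀ h s → dyckFrom h s ∧ noRepeatDown s ≡ accepts h nothing s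
  accepts-afterDown : ∀ h c s → dyckFrom h s ∧ noRepeatDown (down c ∷ s) ≡ accepts h (just c) s

  accepts-fresh h       []           = ∧-identityʳ _
  accepts-fresh h       (up ∷ s)     = accepts-fresh (suc h) s
  accepts-fresh zero    (down c ∷ s) = refl
  accepts-fresh (suc h) (down c ∷ s) = accepts-afterDown h c s

  accepts-afterDown h       c []            = ∧-identityʳ _
  accepts-afterDown h       c (up ∷ s)      = accepts-fresh (suc h) s
  accepts-afterDown zero    c (down c′ ∷ s) = refl
  accepts-afterDown (suc h) c (down c′ ∷ s) with does (c ≟ c′)
  ... | true  = ∧-zeroʳ _
  ... | false = accepts-afterDown h c′ s

  accepts⇒dyckFrom : ∀ h last s → accepts h last s ≡ true → dyckFrom h s ≡ true
  accepts⇒dyckFrom h       last []           acc = acc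
  accepts⇒dyckFrom h       last (up ∷ s)     acc = accepts⇒dyckFrom (suc h) nothing s acc
  accepts⇒dyckFrom (suc h) last (down c ∷ s) acc with allowed last c
  ... | true = accepts⇒dyckFrom h (just c) s acc

  Σ-accepted : ℕ → Maybe (Fin r) → ℕ → (List (Step r) → ℤ) → ℤ
  Σ-accepted h last m F = sum (map (λ s → ⟦ accepts h last s ⟧ * F s) (words r m))

  Σ-colours : (Fin r → ℤ) → ℤ
  Σ-colours f = sum (map f (allFin r))

  private
    ⟦∧⟧-* : ∀ a b x → ⟦ a ∧ b ⟧ * x ≡ ⟦ a ⟧ * (⟦ b ⟧ * x)
    ⟦∧⟧-* true  b x = sym (ℤ.*-identityˡ _)
    ⟦∧⟧-* false b x = refl

  sum-words-suc : ∀ (G : List (Step r) → ℤ) m →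
    sum (map G (words r (suc m))) ≡ sum (map (λ s → G (up ∷ s) + Σ-colours (λ c → G (down c ∷ s))) (words r m))
  sum-words-suc G m = trans (sum-concatMap _ G (words r m)) (sum-map-cong (words r m) λ s →
    cong (λ t → G (up ∷ s) + sum t) (sym (map-∘ {g = G} {f = λ c → down c ∷ s} (allFin r))))

  Σ-accepted-ground : ∀ last m F → Σ-accepted 0 last (suc m) F ≡ Σ-accepted 1 nothing m (F ∘ (up ∷_))
  Σ-accepted-ground last m F = trans (sum-words-suc _ m) (sum-map-cong (words r m) λ s →
    trans (cong (_+_ (⟦ accepts 1 nothing s ⟧ * F (up ∷ s))) (sum-map-0 (allFin r))) (ℤ.+-identityʳ _))

  Σ-accepted-suc : ∀ h last m F →
    Σ-accepted (suc h) last (suc m) F ≡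
    Σ-accepted (suc (suc h)) nothing m (F ∘ (up ∷_))
      + Σ-colours (λ c → ⟦ allowed last c ⟧ * Σ-accepted h (just c) m (F ∘ (down c ∷_)))
  Σ-accepted-suc h last m F = begin
    sum (map (λ s → ⟦ accepts (suc h) last s ⟧ * F s) (words r (suc m)))
      ≡⟨ sum-words-suc _ m ⟩
    sum (map (λ s → ⟦ accepts (suc (suc h)) nothing s ⟧ * F (up ∷ s) + Σ-colours (λ c → G c s)) (words r m))
      ≡⟨ sum-map-+ _ _ (words r m) ⟩
    Up + sum (map (λ s → Σ-colours (λ c → G c s)) (words r m))
      ≡⟨ cong (_+_ Up) (sum-map-swap (λ s c → G c s) (words r m) (allFin r)) ⟩
    Up + Σ-colours (λ c → sum (map (G c) (words r m)))
      ≡⟨ cong (_+_ Up) (sum-map-cong (allFin r) λ c →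
           trans (sum-map-cong (words r m) (λ s → ⟦∧⟧-* (allowed last c) _ _))
                 (sum-map-*ˡ ⟦ allowed last c ⟧ (λ s → ⟦ accepts h (just c) s ⟧ * F (down c ∷ s))
                             (words r m))) ⟩
    Up + Σ-colours (λ c → ⟦ allowed last c ⟧ * Σ-accepted h (just c) m (F ∘ (down c ∷_))) ∎
    where
    open ≡-Reasoning
    Up : ℤ
    Up = Σ-accepted (suc (suc h)) nothing m (F ∘ (up ∷_))
    G : Fin r → List (Step r) → ℤ
    G c s = ⟦ allowed last c ∧ accepts h (just c) s ⟧ * F (down c ∷ s)

  Σ-accepted-+ : ∀ h last m F G →
    Σ-accepted h last m (λ s → F s + G s) ≡ Σ-accepted h last m F + Σ-accepted h last m G
  Σ-accepted-+ h last m F G = trans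
    (sum-map-cong (words r m) (λ s → ℤ.*-distribˡ-+ ⟦ accepts h last s ⟧ (F s) (G s)))
    (sum-map-+ _ _ (words r m))

  Σ-accepted-*ˡ : ∀ h last m c F → Σ-accepted h last m (λ s → c * F s) ≡ c * Σ-accepted h last m F
  Σ-accepted-*ˡ h last m c F = trans
    (sum-map-cong (words r m) (λ s → x*[y*z]≡y*[x*z] ⟦ accepts h last s ⟧ c (F s)))
    (sum-map-*ˡ c _ (words r m))
    where
    x*[y*z]≡y*[x*z] : ∀ x y z → x * (y * z) ≡ y * (x * z)
    x*[y*z]≡y*[x*z] = solve-∀

  Σ-accepted-sum : ∀ {I : Set} h last m (F : I → List (Step r) → ℤ) is →
    sum (map (λ i → Σ-accepted h last m (F i)) is) ≡ Σ-accepted h last m (λ s → sum (map (λ i → F i s) is))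
  Σ-accepted-sum h last m F is = trans
    (sum-map-swap (λ i s → ⟦ accepts h last s ⟧ * F i s) is (words r m))
    (sum-map-cong (words r m) (λ s → sum-map-*ˡ ⟦ accepts h last s ⟧ (λ i → F i s) is))

  Σ-accepted-cong : ∀ h last m {F G} → (∀ s → accepts h last s ≡ true → length s ≡ m → F s ≡ G s) →
                    Σ-accepted h last m F ≡ Σ-accepted h last m G
  Σ-accepted-cong zero    last zero    F≗G = cong (λ t → 1ℤ * t + 0ℤ) (F≗G [] refl refl)
  Σ-accepted-cong (suc h) last zero    F≗G = refl
  Σ-accepted-cong zero    last (suc m) F≗G =
    trans (Σ-accepted-ground last m _)
          (trans (Σ-accepted-cong 1 nothing m (λ s acc len → F≗G (up ∷ s) acc (cong suc len)))
                 (sym (Σ-accepted-ground last m _)))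
  Σ-accepted-cong (suc h) last (suc m) {F} {G} F≗G = begin
    Σ-accepted (suc h) last (suc m) F
      ≡⟨ Σ-accepted-suc h last m F ⟩
    Σ-accepted (suc (suc h)) nothing m (F ∘ (up ∷_))
      + Σ-colours (λ c → ⟦ allowed last c ⟧ * Σ-accepted h (just c) m (F ∘ (down c ∷_)))
      ≡⟨ cong₂ _+_ (Σ-accepted-cong (suc (suc h)) nothing m (λ s acc len → F≗G (up ∷ s) acc (cong suc len)))
                   (sum-map-cong (allFin r) per-colour) ⟩
    Σ-accepted (suc (suc h)) nothing m (G ∘ (up ∷_))
      + Σ-colours (λ c → ⟦ allowed last c ⟧ * Σ-accepted h (just c) m (G ∘ (down c ∷_)))
      ≡⟨ Σ-accepted-suc h last m G ⟨
    Σ-accepted (suc h) last (suc m) G ∎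
    where
    open ≡-Reasoning
    per-colour : ∀ c → ⟦ allowed last c ⟧ * Σ-accepted h (just c) m (F ∘ (down c ∷_))
                     ≡ ⟦ allowed last c ⟧ * Σ-accepted h (just c) m (G ∘ (down c ∷_))
    per-colour c with allowed last c in allowed≡
    ... | true  = cong (_*_ 1ℤ) (Σ-accepted-cong h (just c) m λ s acc len →
                    F≗G (down c ∷ s) (trans (cong (_∧ accepts h (just c) s) allowed≡) acc) (cong suc len))
    ... | false = refl

  private
    suc-* : ∀ n x → x + + n * x ≡ + suc n * x
    suc-* n x = trans (distrib (+ n) x) (cong (_* x) (sym (ℤ.pos-+ 1 n)))
      where
      distrib : ∀ k x → x + k * x ≡ (1ℤ + k) * x
      distrib = solve-∀

  sum-const : ∀ n x → sum (tabulate {n = n} (λ _ → x)) ≡ + n * x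
  sum-const zero    x = refl
  sum-const (suc n) x = trans (cong (_+_ x) (sum-const n x)) (suc-* n x)

  sum-others : ∀ n (c₀ : Fin (suc n)) x → sum (tabulate (λ c → ⟦ not (does (c₀ ≟ c)) ⟧ * x)) ≡ + n * x
  sum-others n       fzero     x =
    trans (ℤ.+-identityˡ _) (trans (sum-const n (1ℤ * x)) (cong (_*_ (+ n)) (ℤ.*-identityˡ x)))
  sum-others (suc n) (fsuc c₀) x = trans (cong₂ _+_ (ℤ.*-identityˡ x) (sum-others n c₀ x)) (suc-* n x)

  allowed-count : ∀ last x → Σ-colours (λ c → ⟦ allowed last c ⟧ * x) ≡ + choices (prev last) * x
  allowed-count nothing   x = begin
    Σ-colours (λ c → ⟦ allowed nothing c ⟧ * x)
      ≡⟨ cong sum (map-tabulate id (λ c → ⟦ allowed nothing c ⟧ * x)) ⟩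
    sum (tabulate {n = r} (λ _ → 1ℤ * x))
      ≡⟨ sum-const r (1ℤ * x) ⟩
    + r * (1ℤ * x)
      ≡⟨ cong (_*_ (+ r)) (ℤ.*-identityˡ x) ⟩
    + r * x ∎
    where open ≡-Reasoning
  allowed-count (just c₀) x =
    trans (cong sum (map-tabulate id (λ c → ⟦ allowed (just c₀) c ⟧ * x))) (sum-others r₁ c₀ x)

  walks-transfer : ∀ h last m → Σ-accepted h last m (λ _ → 1ℤ) ≡ walksℤ (prev last) h m
  walks-transfer zero    last zero    = refl
  walks-transfer (suc h) last zero    = refl
  walks-transfer zero    last (suc m) = trans (Σ-accepted-ground last m _) (walks-transfer 1 nothing m)
  walks-transfer (suc h) last (suc m) = begin
    Σ-accepted (suc h) last (suc m) (λ _ → 1ℤ)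
      ≡⟨ Σ-accepted-suc h last m _ ⟩
    Σ-accepted (suc (suc h)) nothing m (λ _ → 1ℤ)
      + Σ-colours (λ c → ⟦ allowed last c ⟧ * Σ-accepted h (just c) m (λ _ → 1ℤ))
      ≡⟨ cong₂ _+_ (walks-transfer (suc (suc h)) nothing m)
                   (sum-map-cong (allFin r) (λ c → cong (_*_ ⟦ allowed last c ⟧) (walks-transfer h (just c) m))) ⟩
    walksℤ free (suc (suc h)) m + Σ-colours (λ c → ⟦ allowed last c ⟧ * walksℤ afterDown h m)
      ≡⟨ cong (_+_ (walksℤ free (suc (suc h)) m)) (allowed-count last _) ⟩
    walksℤ free (suc (suc h)) m + + choices (prev last) * walksℤ afterDown h m
      ≡⟨ walksℤ-suc (prev last) h m ⟨
    walksℤ (prev last) (suc h) (suc m) ∎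
    where open ≡-Reasoning

  Σ-accepted-const : ∀ h last m x → Σ-accepted h last m (λ _ → x) ≡ x * walksℤ (prev last) h m
  Σ-accepted-const h last m x = begin
    Σ-accepted h last m (λ _ → x)
      ≡⟨ sum-map-cong (words r m) (λ s → cong (_*_ ⟦ accepts h last s ⟧) (ℤ.*-identityʳ x)) ⟨
    Σ-accepted h last m (λ _ → x * 1ℤ)
      ≡⟨ Σ-accepted-*ˡ h last m x (λ _ → 1ℤ) ⟩
    x * Σ-accepted h last m (λ _ → 1ℤ)
      ≡⟨ cong (_*_ x) (walks-transfer h last m) ⟩
    x * walksℤ (prev last) h m ∎
    where open ≡-Reasoning

  signedDowns-transfer : ∀ h last m → Σ-accepted h last m (downSum σ h) ≡ signedDowns (prev last) h m
  signedDowns-transfer zero    last zero    = refl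
  signedDowns-transfer (suc h) last zero    = refl
  signedDowns-transfer zero    last (suc m) =
    trans (Σ-accepted-ground last m _) (signedDowns-transfer 1 nothing m)
  signedDowns-transfer (suc h) last (suc m) = begin
    Σ-accepted (suc h) last (suc m) (downSum σ (suc h))
      ≡⟨ Σ-accepted-suc h last m _ ⟩
    Σ-accepted (suc (suc h)) nothing m (downSum σ (suc (suc h)))
      + Σ-colours (λ c → ⟦ allowed last c ⟧ * Σ-accepted h (just c) m (λ s → σ h + downSum σ h s))
      ≡⟨ cong₂ _+_ (signedDowns-transfer (suc (suc h)) nothing m) (sum-map-cong (allFin r) per-colour) ⟩
    signedDowns free (suc (suc h)) m + Σ-colours (λ c → ⟦ allowed last c ⟧ * downs)
      ≡⟨ cong (_+_ (signedDowns free (suc (suc h)) m)) (allowed-count last downs) ⟩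
    signedDowns (prev last) (suc h) (suc m) ∎
    where
    open ≡-Reasoning
    downs : ℤ
    downs = signedDowns afterDown h m + σ h * walksℤ afterDown h m
    per-colour : ∀ c → ⟦ allowed last c ⟧ * Σ-accepted h (just c) m (λ s → σ h + downSum σ h s)
                     ≡ ⟦ allowed last c ⟧ * downs
    per-colour c = cong (_*_ ⟦ allowed last c ⟧) (begin
      Σ-accepted h (just c) m (λ s → σ h + downSum σ h s)
        ≡⟨ Σ-accepted-+ h (just c) m (λ _ → σ h) (downSum σ h) ⟩
      Σ-accepted h (just c) m (λ _ → σ h) + Σ-accepted h (just c) m (downSum σ h)
        ≡⟨ cong₂ _+_ (Σ-accepted-const h (just c) m (σ h)) (signedDowns-transfer h (just c) m) ⟩
      σ h * walksℤ afterDown h m + signedDowns afterDown h m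
        ≡⟨ ℤ.+-comm (σ h * walksℤ afterDown h m) (signedDowns afterDown h m) ⟩
      downs ∎)

  pos-sum : ∀ {X : Set} (f : X → ℕ) xs → + sumℕ (map f xs) ≡ sum (map (λ x → + f x) xs)
  pos-sum f []       = refl
  pos-sum f (x ∷ xs) = trans (ℤ.pos-+ (f x) _) (cong (_+_ (+ f x)) (pos-sum f xs))

  sum-filter : ∀ {X : Set} (b : X → Bool) (G : X → ℤ) xs →
    sum (map G (filter (λ x → T? (b x)) xs)) ≡ sum (map (λ x → ⟦ b x ⟧ * G x) xs)
  sum-filter b G []       = refl
  sum-filter b G (x ∷ xs) with b x
  ... | true  = cong₂ _+_ (sym (ℤ.*-identityˡ (G x))) (sum-filter b G xs)
  ... | false = sym (trans (ℤ.+-identityˡ _) (sym (sum-filter b G xs)))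

  P≡Σ-accepted : ∀ N ℓ → + P r N ℓ ≡ Σ-accepted 0 nothing (double N) (λ s → + pointsAt ℓ 0 s)
  P≡Σ-accepted N ℓ = begin
    + sumℕ (map (pointsAt ℓ 0) (A r N))
      ≡⟨ pos-sum (pointsAt ℓ 0) (A r N) ⟩
    sum (map (λ s → + pointsAt ℓ 0 s) (A r N))
      ≡⟨ sum-filter valid _ (words r (2 N.* N)) ⟩
    sum (map (λ s → ⟦ valid s ⟧ * + pointsAt ℓ 0 s) (words r (2 N.* N)))
      ≡⟨ sum-map-cong (words r (2 N.* N)) (λ s → cong (λ b → ⟦ b ⟧ * + pointsAt ℓ 0 s) (accepts-fresh 0 s)) ⟩
    Σ-accepted 0 nothing (2 N.* N) (λ s → + pointsAt ℓ 0 s)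
      ≡⟨ cong (λ m → Σ-accepted 0 nothing m (λ s → + pointsAt ℓ 0 s)) (double≡2* N) ⟨
    Σ-accepted 0 nothing (double N) (λ s → + pointsAt ℓ 0 s) ∎
    where
    open ≡-Reasoning
    double≡2* : ∀ k → double k ≡ 2 N.* k
    double≡2* k = trans (double≡+ k) (cong (N._+_ k) (sym (N.+-identityʳ k)))

  signedTerms≡Σ-accepted : ∀ n → let M = suc n in
    sumℤ (applyUpTo (λ i → signedTerm r n (suc i)) M) ≡
    Σ-accepted 0 nothing (double M) (λ s → sum (map (λ i → weight (suc i) * + pointsAt (suc i) 0 s) (upTo M)))
  signedTerms≡Σ-accepted n = begin
    sumℤ (applyUpTo (λ i → signedTerm r n (suc i)) M)
      ≡⟨ cong sumℤ (map-upTo (λ i → signedTerm r n (suc i)) M) ⟨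
    sum (map (λ i → signedTerm r n (suc i)) (upTo M))
      ≡⟨ sum-map-cong (upTo M) signedTerm≡Σ-accepted ⟩
    sum (map (λ i → Σ-accepted 0 nothing (double M) (weighted i)) (upTo M))
      ≡⟨ Σ-accepted-sum 0 nothing (double M) weighted (upTo M) ⟩
    Σ-accepted 0 nothing (double M) (λ s → sum (map (λ i → weighted i s) (upTo M))) ∎
    where
    open ≡-Reasoning
    M : ℕ
    M = suc n
    weighted : ℕ → List (Step r) → ℤ
    weighted i s = weight (suc i) * + pointsAt (suc i) 0 s
    signedTerm≡Σ-accepted : ∀ i → signedTerm r n (suc i) ≡ Σ-accepted 0 nothing (double M) (weighted i)
    signedTerm≡Σ-accepted i = begin
      signedTerm r n (suc i)
        ≡⟨ signedTerm≡ r n (suc i) ⟩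
      weight (suc i) * + P r M (suc i)
        ≡⟨ cong (_*_ (weight (suc i))) (P≡Σ-accepted M (suc i)) ⟩
      weight (suc i) * Σ-accepted 0 nothing (double M) (λ s → + pointsAt (suc i) 0 s)
        ≡⟨ Σ-accepted-*ˡ 0 nothing (double M) (weight (suc i)) _ ⟨
      Σ-accepted 0 nothing (double M) (weighted i) ∎

-- For r = 1 the identity holds as well; the hypothesis only excludes r = 0.
corollary3p3 : (r n : ℕ) → 2 ≤ r →
    sumℤ (applyUpTo (λ i → signedTerm r n (suc i)) (suc n))
    ≡ + sumℕ (applyUpTo (λ ℓ → S r (suc ℓ)) (suc n))
corollary3p3 zero     n ()
corollary3p3 (suc r₁) n _ = begin
  sumℤ (applyUpTo (λ i → signedTerm (suc r₁) n (suc i)) M)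
    ≡⟨ signedTerms≡Σ-accepted n ⟩
  Σ-accepted 0 nothing (double M) (λ s → sumℤ (map (λ i → weight (suc i) ℤ.* + pointsAt (suc i) 0 s) (upTo M)))
    ≡⟨ Σ-accepted-cong 0 nothing (double M) (λ s accepted length≡ →
         signedPoints≡signedDowns M s (accepts⇒dyckFrom 0 nothing s accepted) length≡) ⟩
  Σ-accepted 0 nothing (double M) (downSum σ 0)
    ≡⟨ signedDowns-transfer 0 nothing (double M) ⟩
  signedDowns free 0 (double M)
    ≡⟨ signedDowns-closed n ⟩
  + sumℕ (applyUpTo (λ ℓ → S (suc r₁) (suc ℓ)) M) ∎
  where
  open ≡-Reasoning
  open import Data.List using (upTo)
  open import Data.Maybe using (nothing)
  open LevelSums using (weight; σ; downSum; signedPoints≡signedDowns)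
  open SignedWalks r₁ using (signedDowns; signedDowns-closed)
  open PathSums r₁
  M : ℕ
  M = suc n
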